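{- Let $k \geq 0$, let $(M, w_d)$ be a pointed model with $M = (W, R, V)$, and let $x,y \in W \setminus \{w_d\}$ be two distinct worlds such that $b(x) \geq b(y) \geq 0$ and $x \sim_{b(y)} y$. Let $(M', w_d)$ with $M' = (W', R', V')$ be the pointed model defined by $W' = W \setminus \{y\}$, $R'_i = (R_i \cap (W' \times W')) \cup \{(w, x) \mid w R_i y\}$ for each $i\in\mathcal{I}$, and $V'(p) = V(p) \cap W'$ for all $p \in \mathcal{P}$ (i.e., $y$ is deleted and its incoming edges are redirected to $x$). Then $(M, w_d) \sim_k (M', w_d)$.
   Context: Fix a countable set $\mathcal{P}$ of atomic propositions and a finite set $\mathcal{I}$ of modality indices. A model is $M=(W,R,V)$ where $W$ is a finite nonempty set of worlds, $R$ assigns to each $i\in\mathcal{I}$ a relation $R_i\subseteq W\times W$ (write $wR_iv$), and $V:\mathcal{P}\to 2^W$. A pointed model is $(M,w_d)$ with $w_d\in W$. For $k\ge 0$, a $k$-bisimulation between pointed models $(M,w_d)$ and $(M',w'_d)$ (with $M'=(W',R',V')$) is a sequence of nonempty relations $Z_k\subseteq\cdots\subseteq Z_0\subseteq W\times W'$ with $(w_d,w'_d)\in Z_k$ such that: (atom) if $(w,w')\in Z_0$ then for all $p$, $w\in V(p)$ iff $w'\in V'(p)$; and for all $h<k$ and $i\in\mathcal{I}$: (forth) if $(w,w')\in Z_{h+1}$ and $wR_iv$ then there is $v'$ with $w'R'_iv'$ and $(v,v')\in Z_h$; (back) if $(w,w')\in Z_{h+1}$ and $w'R'_iv'$ then there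 is $v$ with $wR_iv$ and $(v,v')\in Z_h$. If such a sequence exists we write $(M,w_d)\sim_k(M',w'_d)$. For worlds $w,v$ of the same model $M$, $w\sim_h v$ means $(M,w)\sim_h(M,v)$. The depth $d(w)$ of a world $w$ (with respect to $(M,w_d)$) is the length of a shortest path (sequence of worlds joined by edges of any $R_i$) from $w_d$ to $w$ ($\infty$ if none), and its bound is $b(w)=k-d(w)$; in the claim, bounds refer to $(M,w_d)$. -}

module Defs where

open import Data.Nat using (ℕ; zero; suc; _≤_; _<_)
open import Data.Fin using (Fin)
open import Data.Product using (Σ; _×_; _,_; ∃₂)
open import Data.Sum using (_⊎_)
open import Relation.Binary.PropositionalEquality using (_≡_; _≢_)

-- A Kripke model over a set of worlds W with modality indices Fin m
-- (the finite index set I) and atomic propositions indexed by ℕ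
-- (the countable set P).
record Model (m : ℕ) (W : Set) : Set₁ where
  field
    R : Fin m → W → W → Set
    V : ℕ → W → Set
open Model public

-- k-bisimulation between pointed models (M , wd) and (M' , wd').
-- Z h is the relation Z_h; only indices h ≤ k are constrained.
record Bisim {m : ℕ} {W W' : Set} (k : ℕ)
             (M : Model m W) (wd : W) (M' : Model m W') (wd' : W') : Set₁ where
  field
    Z        : ℕ → W → W' → Set
    nonempty : ∀ h → h ≤ k → ∃₂ λ w w' → Z h w w'
    mono     : ∀ h → h < k → ∀ w w' → Z (suc h) w w' → Z h w w'
    root     : Z k wd wd'
    atom     : ∀ w w' → Z 0 w w' → ∀ p → (V M p w → V M' p w') × (V M' p w' → V M p w)
    forth    : ∀ h → h < k → ∀ (i : Fin m) w w' → Z (suc h) w w' →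
               ∀ v → R M i w v → Σ W' λ v' → R M' i w' v' × Z h v v'
    back     : ∀ h → h < k → ∀ (i : Fin m) w w' → Z (suc h) w w' →
               ∀ v' → R M' i w' v' → Σ W λ v → R M i w v × Z h v v'

_,_∼[_]_,_ : {m : ℕ} {W W' : Set} → Model m W → W → ℕ → Model m W' → W' → Set₁
M , wd ∼[ k ] M' , wd' = Bisim k M wd M' wd'

data Path {m : ℕ} {W : Set} (M : Model m W) : W → W → ℕ → Set where
  here : ∀ {u} → Path M u u 0
  step : ∀ {u v w n} (i : Fin m) → R M i u v → Path M v w n → Path M u w (suc n)

-- d(w) = n w.r.t. the pointed model (M , wd): n is the length of a shortest path.
-- (d(w) = ∞ is the case where no such n exists.)
IsDepth : {m : ℕ} {W : Set} → Model m W → W → W → ℕ → Set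
IsDepth M wd w n = Path M wd w n × (∀ j → Path M wd w j → n ≤ j)

Del : (W : Set) → W → Set
Del W y = Σ W λ w → w ≢ y

redirect : {m : ℕ} {W : Set} → Model m W → (x y : W) → Model m (Del W y)
R (redirect M x y) i (w , _) (v , _) = R M i w v ⊎ (v ≡ x × R M i w y)
V (redirect M x y) p (w , _) = V M p w

{-# OPTIONS --safe #-}
module Submission where

-- Compare M with M' = redirect M x y through h-bisimilarity defined by
-- recursion on h, which is equivalent to having an h-bisimulation. Show that
-- every w ≠ y reachable from wd in n steps, with h + n ≤ k, is h-bisimilar to
-- itself in M'. An M-edge into any v ≠ y is matched by the same edge of M';
-- an edge into y is matched by the redirected edge into x. For that second
-- kind of edge, y is h-bisimilar to x within M because h ≤ k ∸ dy. Since
-- dx ≤ dy, x has at least the same budget, so x in M is h-bisimilar to x in M'.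
-- Transitivity finishes the step.

open import Defs
open import Data.Nat using (ℕ; zero; suc; _≤_; _∸_; _+_; z≤n; s≤s)
open import Data.Nat.Properties
  using (≤-refl; ≤-reflexive; ≤-trans; n≤1+n; +-identityʳ; +-suc; +-monoʳ-≤; m+n≤o⇒m≤o∸n)
open import Data.Fin using (Fin)
open import Data.Fin.Properties using (_≟_)
open import Data.Product using (Σ; _×_; _,_; proj₁; proj₂)
open import Data.Sum using (inj₁; inj₂)
open import Function using (id; _∘_)
open import Relation.Nullary using (yes; no)
open import Relation.Binary.Definitions using (DecidableEquality)
open import Relation.Binary.PropositionalEquality using (_≢_; refl; sym; subst)

module _ {m : ℕ} {W W' : Set} (M : Model m W) (M' : Model m W') where

  SameAtoms : W → W' → Set
  SameAtoms w w' = ∀ p → (V M p w → V M' p w') × (V M' p w' → V M p w)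

  Forth Back : (W → W' → Set) → W → W' → Set
  Forth Z w w' = ∀ i v → R M i w v → Σ W' λ v' → R M' i w' v' × Z v v'
  Back Z w w' = ∀ i v' → R M' i w' v' → Σ W λ v → R M i w v × Z v v'

  Bisimilar : ℕ → W → W' → Set
  Bisimilar zero w w' = SameAtoms w w'
  Bisimilar (suc h) w w' =
    SameAtoms w w' × Forth (Bisimilar h) w w' × Back (Bisimilar h) w w'

module _ {m : ℕ} {W W' : Set} {M : Model m W} {M' : Model m W'} where

  Bisimilar-atoms : ∀ h {w w'} → Bisimilar M M' h w w' → SameAtoms M M' w w'
  Bisimilar-atoms zero    e = e
  Bisimilar-atoms (suc h) e = proj₁ e

  Bisimilar-≤ : ∀ {h j w w'} → h ≤ j → Bisimilar M M' j w w' → Bisimilar M M' h w w'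
  Bisimilar-≤ {j = j} z≤n e = Bisimilar-atoms j e
  Bisimilar-≤ (s≤s h≤j) (at , fw , bw) =
    at ,
    (λ i v r → let (v' , r' , e) = fw i v r in v' , r' , Bisimilar-≤ h≤j e) ,
    (λ i v' r' → let (v , r , e) = bw i v' r' in v , r , Bisimilar-≤ h≤j e)

  SameAtoms-sym : ∀ {w w'} → SameAtoms M M' w w' → SameAtoms M' M w' w
  SameAtoms-sym at p = let (f , g) = at p in g , f

  Bisimilar-sym : ∀ h {w w'} → Bisimilar M M' h w w' → Bisimilar M' M h w' w
  Bisimilar-sym zero    at = SameAtoms-sym at
  Bisimilar-sym (suc h) (at , fw , bw) =
    SameAtoms-sym at ,
    (λ i v' r' → let (v , r , e) = bw i v' r' in v , r , Bisimilar-sym h e) ,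
    (λ i v r → let (v' , r' , e) = fw i v r in v' , r' , Bisimilar-sym h e)

  Bisim⇒Bisimilar : ∀ {k wd wd'} → M , wd ∼[ k ] M' , wd' → Bisimilar M M' k wd wd'
  Bisim⇒Bisimilar {k} B = Z⇒Bisimilar k ≤-refl (Bisim.root B)
    where
    open Bisim B
    Z⇒Bisimilar : ∀ h → h ≤ k → ∀ {w w'} → Z h w w' → Bisimilar M M' h w w'
    Z⇒Bisimilar zero    _   {w} {w'} z = atom w w' z
    Z⇒Bisimilar (suc h) h<k {w} {w'} z =
      Bisimilar-atoms h (Z⇒Bisimilar h h≤k (mono h h<k w w' z)) ,
      (λ i v r → let (v' , r' , z') = forth h h<k i w w' z v r in
                 v' , r' , Z⇒Bisimilar h h≤k z') ,
      (λ i v' r' → let (v , r , z') = back h h<k i w w' z v' r' in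
                   v , r , Z⇒Bisimilar h h≤k z')
      where
      h≤k : h ≤ k
      h≤k = ≤-trans (n≤1+n h) h<k

  Bisimilar⇒Bisim : ∀ {k wd wd'} → Bisimilar M M' k wd wd' → M , wd ∼[ k ] M' , wd'
  Bisimilar⇒Bisim {wd = wd} {wd'} root = record
    { Z        = Bisimilar M M'
    ; nonempty = λ h h≤k → wd , wd' , Bisimilar-≤ h≤k root
    ; mono     = λ h _ _ _ → Bisimilar-≤ (n≤1+n h)
    ; root     = root
    ; atom     = λ _ _ → id
    ; forth    = λ _ _ i _ _ e → proj₁ (proj₂ e) i
    ; back     = λ _ _ i _ _ e → proj₂ (proj₂ e) i
    }

module _ {m : ℕ} {W₁ W₂ W₃ : Set}
         {M₁ : Model m W₁} {M₂ : Model m W₂} {M₃ : Model m W₃} where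

  SameAtoms-trans : ∀ {a b c} → SameAtoms M₁ M₂ a b → SameAtoms M₂ M₃ b c →
                    SameAtoms M₁ M₃ a c
  SameAtoms-trans ab bc p =
    (proj₁ (bc p) ∘ proj₁ (ab p)) , (proj₂ (ab p) ∘ proj₂ (bc p))

  Bisimilar-trans : ∀ h {a b c} → Bisimilar M₁ M₂ h a b → Bisimilar M₂ M₃ h b c →
                    Bisimilar M₁ M₃ h a c
  Bisimilar-trans zero at₁ at₂ = SameAtoms-trans at₁ at₂
  Bisimilar-trans (suc h) (at₁ , fw₁ , bw₁) (at₂ , fw₂ , bw₂) =
    SameAtoms-trans at₁ at₂ ,
    (λ i a' r₁ → let (b' , r₂ , e₁) = fw₁ i a' r₁
                     (c' , r₃ , e₂) = fw₂ i b' r₂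
                 in c' , r₃ , Bisimilar-trans h e₁ e₂) ,
    (λ i c' r₃ → let (b' , r₂ , e₂) = bw₂ i c' r₃
                     (a' , r₁ , e₁) = bw₁ i b' r₂
                 in a' , r₁ , Bisimilar-trans h e₁ e₂)

Path-snoc : ∀ {m W} {M : Model m W} {u v w n} (i : Fin m) →
            Path M u v n → R M i v w → Path M u w (suc n)
Path-snoc i here          r = step i r here
Path-snoc i (step j r' p) r = step j r' (Path-snoc i p r)

module Redirect {m : ℕ} {W : Set} (_≟ᵂ_ : DecidableEquality W)
                (M : Model m W) (wd x y : W) (x≢y : x ≢ y) (k dx dy : ℕ)
                (wd→x : Path M wd x dx) (dy-min : ∀ j → Path M wd y j → dy ≤ j)
                (dx≤dy : dx ≤ dy) (y≈x : Bisimilar M M (k ∸ dy) y x) where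

  M' : Model m (Del W y)
  M' = redirect M x y

  kept-bisimilar : ∀ h {w} (w≢y : w ≢ y) {n} → Path M wd w n → h + n ≤ k →
                   Bisimilar M M' h w (w , w≢y)
  -- The proof of x ≢ y is an argument: a back step hands us an arbitrary one,
  -- and proofs of a negation are not definitionally equal.
  deleted-bisimilar : ∀ h {n} → Path M wd y n → h + n ≤ k →
                      (x≢y' : x ≢ y) → Bisimilar M M' h y (x , x≢y')

  deleted-bisimilar h wd→y h+n≤k x≢y' =
    Bisimilar-trans h (Bisimilar-≤ h≤k∸dy y≈x) (kept-bisimilar h x≢y' wd→x h+dx≤k)
    where
    h+dy≤k : h + dy ≤ k
    h+dy≤k = ≤-trans (+-monoʳ-≤ h (dy-min _ wd→y)) h+n≤k
    h≤k∸dy : h ≤ k ∸ dy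
    h≤k∸dy = m+n≤o⇒m≤o∸n h h+dy≤k
    h+dx≤k : h + dx ≤ k
    h+dx≤k = ≤-trans (+-monoʳ-≤ h dx≤dy) h+dy≤k

  kept-bisimilar zero    _ _ _ _ = id , id
  kept-bisimilar (suc h) {w} w≢y {n} wd→w 1+h+n≤k = (λ _ → id , id) , fw , bw
    where
    h+1+n≤k : h + suc n ≤ k
    h+1+n≤k = subst (_≤ k) (sym (+-suc h n)) 1+h+n≤k
    fw : Forth M M' (Bisimilar M M' h) w (w , w≢y)
    fw i v r with v ≟ᵂ y
    ... | no v≢y   = (v , v≢y) , inj₁ r ,
                     kept-bisimilar h v≢y (Path-snoc i wd→w r) h+1+n≤k
    ... | yes refl = (x , x≢y) , inj₂ (refl , r) ,
                     deleted-bisimilar h (Path-snoc i wd→w r) h+1+n≤k x≢y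
    bw : Back M M' (Bisimilar M M' h) w (w , w≢y)
    bw i (v , v≢y) (inj₁ r)          =
      v , r , kept-bisimilar h v≢y (Path-snoc i wd→w r) h+1+n≤k
    bw i (v , v≢y) (inj₂ (refl , r)) =
      y , r , deleted-bisimilar h (Path-snoc i wd→w r) h+1+n≤k v≢y

lemma3p5 : (m n k : ℕ) (M : Model m (Fin n)) (wd x y : Fin n) →
           x ≢ wd → (wd≢y : wd ≢ y) → x ≢ y →
           (dx dy : ℕ) → IsDepth M wd x dx → IsDepth M wd y dy →
           dx ≤ dy → dy ≤ k →
           M , x ∼[ k ∸ dy ] M , y →
           M , wd ∼[ k ] redirect M x y , (wd , wd≢y)
lemma3p5 m n k M wd x y _ wd≢y x≢y dx dy (wd→x , _) (_ , dy-min) dx≤dy _ x∼y =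
  Bisimilar⇒Bisim (kept-bisimilar k wd≢y here (≤-reflexive (+-identityʳ k)))
  where
  open Redirect _≟_ M wd x y x≢y k dx dy wd→x dy-min dx≤dy
                (Bisimilar-sym (k ∸ dy) (Bisim⇒Bisimilar x∼y))
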